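{- Let $q$ be a prime power and $n \ge 3$ an integer. Then $\mathcal{A}_q(n,n-1,n-2;q) \le \mathcal{A}^r_q(n,n-1,n-2;q) \le q^{n-1}$.
   Context: A $t$-$(n,k,\lambda)_q$ subspace packing is a collection (possibly a multiset) of $k$-dimensional subspaces (blocks) of $\mathbb{F}_q^n$ such that every $t$-dimensional subspace of $\mathbb{F}_q^n$ is contained in at most $\lambda$ blocks, counted with multiplicity. $\mathcal{A}_q(n,k,t;\lambda)$ denotes the maximum number of blocks in such a packing without repeated blocks, and $\mathcal{A}^r_q(n,k,t;\lambda)$ the maximum number of blocks (counted with multiplicity) when repeated blocks are allowed. -}

module Defs where

open import Level using (0ℓ)
open import Data.Nat using (ℕ; zero; suc; _≤_)
open import Data.Fin using (Fin; zero; suc)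
open import Data.Product using (∃; _×_)
open import Relation.Nullary using (¬_)
open import Relation.Binary.PropositionalEquality using (_≡_)
open import Function.Definitions using (Injective)
open import Algebra.Bundles using (CommutativeRing)

-- A finite field with exactly q elements: a commutative ring (with setoid
-- equality _≈_) with 0 ≠ 1, inverses of nonzero elements, and an
-- enumeration Fin q → Carrier that is a bijection up to _≈_.
-- (Finite fields of order q exist exactly when q is a prime power.)
record FiniteField (q : ℕ) : Set₁ where
  field
    commRing : CommutativeRing 0ℓ 0ℓ
  open CommutativeRing commRing public using (Carrier; _≈_; _+_; _*_; 0#; 1#)
  field
    0≉1       : ¬ (0# ≈ 1#)
    inverse   : ∀ x → ¬ (x ≈ 0#) → ∃ λ y → (x * y) ≈ 1#
    enum      : Fin q → Carrier
    enum-inj  : ∀ i j → enum i ≈ enum j → i ≡ j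
    enum-surj : ∀ x → ∃ λ i → enum i ≈ x

module Subspaces {q : ℕ} (F : FiniteField q) where
  open FiniteField F

  Vector : ℕ → Set
  Vector n = Fin n → Carrier

  Σ[<_] : (k : ℕ) → (Fin k → Carrier) → Carrier
  Σ[< zero ] f = 0#
  Σ[< suc k ] f = f zero + Σ[< k ] (λ i → f (suc i))

  InSpan : {k n : ℕ} → (Fin k → Vector n) → Vector n → Set
  InSpan {k} b v = ∃ λ (c : Fin k → Carrier) →
    ∀ j → v j ≈ Σ[< k ] (λ i → c i * b i j)

  LinIndep : {k n : ℕ} → (Fin k → Vector n) → Set
  LinIndep {k} b = ∀ (c : Fin k → Carrier) →
    (∀ j → Σ[< k ] (λ i → c i * b i j) ≈ 0#) → ∀ i → c i ≈ 0#

  record Subspace (k n : ℕ) : Set where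
    field
      basis : Fin k → Vector n
      indep : LinIndep basis
  open Subspace public

  _⊆ˢ_ : {t k n : ℕ} → Subspace t n → Subspace k n → Set
  T ⊆ˢ B = ∀ i → InSpan (basis B) (basis T i)

  SameSubspace : {k n : ℕ} → Subspace k n → Subspace k n → Set
  SameSubspace A B = (A ⊆ˢ B) × (B ⊆ˢ A)

  -- t-(n,k,λ)_q subspace packing, as a multiset of N blocks (an indexed
  -- family, repetitions allowed): every t-subspace T is contained in at
  -- most λ blocks counted with multiplicity, i.e. any injectively chosen
  -- m block indices whose blocks all contain T satisfy m ≤ λ.
  IsPacking : (n k t lam : ℕ) {N : ℕ} → (Fin N → Subspace k n) → Set
  IsPacking n k t lam {N} blocks =
    ∀ (T : Subspace t n) (m : ℕ) (f : Fin m → Fin N) →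
    Injective _≡_ _≡_ f → (∀ j → T ⊆ˢ blocks (f j)) → m ≤ lam

  NoRepeats : {k n N : ℕ} → (Fin N → Subspace k n) → Set
  NoRepeats {N = N} blocks =
    ∀ (i j : Fin N) → SameSubspace (blocks i) (blocks j) → i ≡ j

module Submission where

-- Write n = m + 2 and fix one block B₀ ≅ F^(m+1).  Any other block B,
-- being a hyperplane of F^(m+2), contains a hyperplane of B₀; so B can be
-- labelled by one of the [m+1]_q = 1 + q + ⋯ + q^m hyperplanes of B₀.  All
-- blocks with the same label, together with B₀, contain a common
-- m-dimensional subspace, so by the packing condition a label is used at
-- most q - 1 times.  Hence N ≤ 1 + (q - 1)[m+1]_q = q^(m+1).

open import Defs
open import Data.Nat using (ℕ; _≤_; _∸_; _^_; zero; suc; s≤s)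
open import Data.Fin using (Fin)
open import Data.Product using (_×_; _,_)

module Counting where

  open import Data.Nat using (_+_; _*_; z≤n)
  open import Data.Nat.Properties using (+-mono-≤; *-suc; +-0-commutativeMonoid)
  open import Data.Fin using (zero; suc)
  open import Data.Fin.Properties using (_≟_; suc-injective)
  open import Data.Bool using (if_then_else_)
  open import Relation.Nullary using (does; yes; no)
  open import Relation.Binary.PropositionalEquality using (_≡_; refl; sym; cong; trans; subst)
  open import Function.Definitions using (Injective)
  open import Algebra.Properties.CommutativeMonoid.Sum +-0-commutativeMonoid
    using (sum; ∑-comm; sum-replicate-zero; sum-cong-≋)

  -- The fibre sizes
  -- are sums of indicators, so they add up to K; each fibre is listed
  -- injectively, so its size is at most d.

  δ : ∀ {L} → Fin L → Fin L → ℕ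
  δ i κ = if does (i ≟ κ) then 1 else 0

  sum-δ : ∀ {L} (i : Fin L) → sum (δ i) ≡ 1
  sum-δ {suc L} zero = cong suc (sum-replicate-zero L)
  sum-δ (suc i) = sum-δ i

  fibreSize : ∀ {K L} → (Fin K → Fin L) → Fin L → ℕ
  fibreSize g κ = sum (λ i → δ (g i) κ)

  sum-fibreSize : ∀ {K L} (g : Fin K → Fin L) → sum (fibreSize g) ≡ K
  sum-fibreSize {K} g = trans (∑-comm (λ κ i → δ (g i) κ)) (trans (sum-cong-≋ (λ i → sum-δ (g i))) (ones K))
    where
    ones : ∀ K → sum {K} (λ _ → 1) ≡ K
    ones zero = refl
    ones (suc K) = cong suc (ones K)

  fibre : ∀ {K L} (g : Fin K → Fin L) κ → Fin (fibreSize g κ) → Fin K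
  fibre {suc K} g κ j with g zero ≟ κ
  fibre {suc K} g κ zero    | yes _ = zero
  fibre {suc K} g κ (suc j) | yes _ = suc (fibre (λ i → g (suc i)) κ j)
  fibre {suc K} g κ j       | no _  = suc (fibre (λ i → g (suc i)) κ j)

  fibre-maps-to : ∀ {K L} (g : Fin K → Fin L) κ j → g (fibre g κ j) ≡ κ
  fibre-maps-to {suc K} g κ j with g zero ≟ κ
  fibre-maps-to {suc K} g κ zero    | yes p = p
  fibre-maps-to {suc K} g κ (suc j) | yes _ = fibre-maps-to (λ i → g (suc i)) κ j
  fibre-maps-to {suc K} g κ j       | no _  = fibre-maps-to (λ i → g (suc i)) κ j

  fibre-injective : ∀ {K L} (g : Fin K → Fin L) κ → Injective _≡_ _≡_ (fibre g κ)
  fibre-injective {suc K} g κ {i} {j} e with g zero ≟ κ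
  fibre-injective {suc K} g κ {zero}  {zero}  e | yes _ = refl
  fibre-injective {suc K} g κ {suc i} {suc j} e | yes _ =
    cong suc (fibre-injective (λ i → g (suc i)) κ (suc-injective e))
  fibre-injective {suc K} g κ {i} {j} e | no _ =
    fibre-injective (λ i → g (suc i)) κ (suc-injective e)

  sum-≤ : ∀ {L} d (f : Fin L → ℕ) → (∀ κ → f κ ≤ d) → sum f ≤ d * L
  sum-≤ {zero} d f h = z≤n
  sum-≤ {suc L} d f h =
    subst (sum f ≤_) (sym (*-suc d L)) (+-mono-≤ (h zero) (sum-≤ d (λ κ → f (suc κ)) (λ κ → h (suc κ))))

  pigeonhole-mult : ∀ d {K L} (g : Fin K → Fin L) →
    (∀ κ m (f : Fin m → Fin K) → Injective _≡_ _≡_ f → (∀ j → g (f j) ≡ κ) → m ≤ d) →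
    K ≤ d * L
  pigeonhole-mult d g small = subst (_≤ _) (sum-fibreSize g)
    (sum-≤ d (fibreSize g) (λ κ → small κ _ (fibre g κ) (fibre-injective g κ) (fibre-maps-to g κ)))

-- The q-integers [m]_q = 1 + q + ⋯ + q^(m-1); [m]_q is the number of
-- hyperplanes of an m-dimensional space over a field with q elements.
module QIntegers (q : ℕ) where

  open import Data.Nat using (pred; _+_; _*_; NonZero)
  open import Data.Nat.Properties using (*-zeroʳ; *-distribˡ-+; +-assoc; +-comm; suc-pred)
  open import Relation.Binary.PropositionalEquality using (_≡_; cong; module ≡-Reasoning)
  open ≡-Reasoning

  qint : ℕ → ℕ
  qint zero    = 0
  qint (suc m) = q ^ m + qint m

  qint-identity : .{{NonZero q}} → ∀ m → pred q * qint m + 1 ≡ q ^ m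
  qint-identity zero = cong (_+ 1) (*-zeroʳ (pred q))
  qint-identity (suc m) = begin
    pred q * (q ^ m + qint m) + 1             ≡⟨ cong (_+ 1) (*-distribˡ-+ (pred q) (q ^ m) (qint m)) ⟩
    pred q * q ^ m + pred q * qint m + 1      ≡⟨ +-assoc (pred q * q ^ m) _ 1 ⟩
    pred q * q ^ m + (pred q * qint m + 1)    ≡⟨ cong (pred q * q ^ m +_) (qint-identity m) ⟩
    pred q * q ^ m + q ^ m                    ≡⟨ +-comm (pred q * q ^ m) (q ^ m) ⟩
    suc (pred q) * q ^ m                      ≡⟨ cong (_* q ^ m) (suc-pred q) ⟩
    q * q ^ m                                 ∎

module LinearAlgebra {q : ℕ} (F : FiniteField q) where

  import Data.Nat as ℕ
  import Data.Nat.Properties as ℕ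
  open import Data.Fin using (zero; suc; splitAt; _↑ˡ_; _↑ʳ_; lift; combine)
  open import Data.Sum using (_⊎_; inj₁; inj₂)
  open import Data.Fin.Base using (funToFin; finToFun)
  open import Data.Vec.Functional using (_∷_; tail)
  import Data.Fin.Properties as Fin
  open import Data.Product using (∃; proj₁; proj₂)
  open import Function using (_∘_)
  open import Data.Empty using (⊥-elim)
  open import Relation.Nullary using (¬_; Dec; yes; no)
  import Relation.Binary.PropositionalEquality as ≡
  open ≡ using (_≡_)
  open import Function.Definitions using (Injective)
  open import Algebra.Bundles using (CommutativeRing)
  open Counting using (pigeonhole-mult)
  open QIntegers q using (qint; qint-identity)

  open FiniteField F
  open CommutativeRing commRing
    hiding (Carrier; _≈_; _+_; _*_; 0#; 1#; zero)
  open import Algebra.Properties.Ring ring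
    using (-‿distribˡ-*; -‿distribʳ-*; -1*x≈-x; [y-z]x≈yx-zx; x[y-z]≈xy-xz;
           x∙y⁻¹≈ε⇒x≈y; x≈y⇒x∙y⁻¹≈ε; +-inverseˡ-unique; -0#≈0#; ⁻¹-anti-homo‿-)
  open import Algebra.Properties.Semiring.Sum semiring
    using (sum; ∑-distrib-+; sum-cong-≋; sum-replicate-zero; *-distribˡ-sum; *-distribʳ-sum)
  open Subspaces F
  open import Relation.Binary.Reasoning.Setoid setoid

  Σ≡sum : ∀ k (f : Fin k → Carrier) → Σ[< k ] f ≡ sum f
  Σ≡sum zero    f = ≡.refl
  Σ≡sum (suc k) f = ≡.cong (f zero +_) (Σ≡sum k (λ i → f (suc i)))

  Σ-cong : ∀ k {f g : Fin k → Carrier} → (∀ i → f i ≈ g i) → Σ[< k ] f ≈ Σ[< k ] g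
  Σ-cong k {f} {g} f≈g rewrite Σ≡sum k f | Σ≡sum k g = sum-cong-≋ f≈g

  Σ-+ : ∀ k (f g : Fin k → Carrier) → Σ[< k ] (λ i → f i + g i) ≈ Σ[< k ] f + Σ[< k ] g
  Σ-+ k f g rewrite Σ≡sum k (λ i → f i + g i) | Σ≡sum k f | Σ≡sum k g = ∑-distrib-+ f g

  Σ-*ˡ : ∀ k x (f : Fin k → Carrier) → x * Σ[< k ] f ≈ Σ[< k ] (λ i → x * f i)
  Σ-*ˡ k x f rewrite Σ≡sum k f | Σ≡sum k (λ i → x * f i) = *-distribˡ-sum x f

  Σ-*ʳ : ∀ k x (f : Fin k → Carrier) → Σ[< k ] f * x ≈ Σ[< k ] (λ i → f i * x)
  Σ-*ʳ k x f rewrite Σ≡sum k f | Σ≡sum k (λ i → f i * x) = *-distribʳ-sum x f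

  Σ-zero : ∀ k (f : Fin k → Carrier) → (∀ i → f i ≈ 0#) → Σ[< k ] f ≈ 0#
  Σ-zero k f f≈0 = trans (Σ-cong k f≈0) sum-of-zeros
    where
    sum-of-zeros : Σ[< k ] (λ _ → 0#) ≈ 0#
    sum-of-zeros rewrite Σ≡sum k (λ _ → 0#) = sum-replicate-zero k

  Σ-neg : ∀ k (f : Fin k → Carrier) → Σ[< k ] (λ i → - f i) ≈ - Σ[< k ] f
  Σ-neg k f = begin
    Σ[< k ] (λ i → - f i)      ≈⟨ Σ-cong k (λ i → sym (-1*x≈-x (f i))) ⟩
    Σ[< k ] (λ i → - 1# * f i) ≈⟨ Σ-*ˡ k (- 1#) f ⟨
    - 1# * Σ[< k ] f           ≈⟨ -1*x≈-x _ ⟩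
    - Σ[< k ] f                ∎

  infix 7 _·_
  _·_ : ∀ {k n} → (Fin k → Carrier) → (Fin k → Vector n) → Vector n
  (_·_ {k} c b) t = Σ[< k ] (λ i → c i * b i t)

  unit : ∀ {k} → Fin k → Fin k → Carrier
  unit zero    zero    = 1#
  unit zero    (suc _) = 0#
  unit (suc _) zero    = 0#
  unit (suc i) (suc j) = unit i j

  Σ-unit : ∀ k (i : Fin k) (f : Fin k → Carrier) → Σ[< k ] (λ j → unit i j * f j) ≈ f i
  Σ-unit (suc k) zero f = begin
    1# * f zero + Σ[< k ] (λ j → 0# * f (suc j)) ≈⟨ +-cong (*-identityˡ _) (Σ-zero k _ (λ j → zeroˡ _)) ⟩
    f zero + 0#                                  ≈⟨ +-identityʳ _ ⟩
    f zero                                       ∎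
  Σ-unit (suc k) (suc i) f = begin
    0# * f zero + Σ[< k ] (λ j → unit i j * f (suc j)) ≈⟨ +-cong (zeroˡ _) (Σ-unit k i (λ j → f (suc j))) ⟩
    0# + f (suc i)                                     ≈⟨ +-identityˡ _ ⟩
    f (suc i)                                          ∎

  module _ {k n : ℕ} (b : Fin k → Vector n) where

    span-resp : ∀ {u v : Vector n} → (∀ t → u t ≈ v t) → InSpan b u → InSpan b v
    span-resp u≈v (c , u≈cb) = c , λ t → trans (sym (u≈v t)) (u≈cb t)

    span-zero : InSpan b (λ _ → 0#)
    span-zero = (λ _ → 0#) , λ t → sym (Σ-zero k _ (λ i → zeroˡ _))

    span-+ : ∀ {u v : Vector n} → InSpan b u → InSpan b v → InSpan b (λ t → u t + v t)
    span-+ (c , u≈cb) (d , v≈db) = (λ i → c i + d i) , λ t → begin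
      _                                                      ≈⟨ +-cong (u≈cb t) (v≈db t) ⟩
      (c · b) t + (d · b) t                                  ≈⟨ Σ-+ k _ _ ⟨
      Σ[< k ] (λ i → c i * b i t + d i * b i t)              ≈⟨ Σ-cong k (λ i → distribʳ (b i t) (c i) (d i)) ⟨
      ((λ i → c i + d i) · b) t                              ∎

    span-* : ∀ x {u : Vector n} → InSpan b u → InSpan b (λ t → x * u t)
    span-* x (c , u≈cb) = (λ i → x * c i) , λ t → begin
      _                                      ≈⟨ *-cong refl (u≈cb t) ⟩
      x * (c · b) t                          ≈⟨ Σ-*ˡ k x _ ⟩
      Σ[< k ] (λ i → x * (c i * b i t))      ≈⟨ Σ-cong k (λ i → *-assoc x (c i) (b i t)) ⟨
      ((λ i → x * c i) · b) t                ∎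

    span-member : ∀ i → InSpan b (b i)
    span-member i = unit i , λ t → sym (Σ-unit k i (λ j → b j t))

    span-lincomb : ∀ {m} (y : Fin m → Vector n) → (∀ j → InSpan b (y j)) →
                   ∀ (f : Fin m → Carrier) → InSpan b (f · y)
    span-lincomb {zero}  y y∈ f = span-zero
    span-lincomb {suc m} y y∈ f = span-+ (span-* (f zero) (y∈ zero))
      (span-lincomb (λ j → y (suc j)) (λ j → y∈ (suc j)) (λ j → f (suc j)))

  _⊆span_ : ∀ {k l n} → (Fin l → Vector n) → (Fin k → Vector n) → Set
  u ⊆span b = ∀ j → InSpan b (u j)

  ∷-⊆span : ∀ {k m n} {b : Fin k → Vector n} {x} {u : Fin m → Vector n} →
            InSpan b x → u ⊆span b → (x ∷ u) ⊆span b
  ∷-⊆span x∈b u⊆b zero    = x∈b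
  ∷-⊆span x∈b u⊆b (suc j) = u⊆b j

  span-tail : ∀ {k n} (b : Fin (suc k) → Vector n) {u} → InSpan (λ i → b (suc i)) u → InSpan b u
  span-tail {k} b (c , u≈cb) = (0# ∷ c) , λ t → begin
    _                                     ≈⟨ u≈cb t ⟩
    Σ[< k ] (λ i → c i * b (suc i) t)     ≈⟨ +-identityˡ _ ⟨
    0# + _                                ≈⟨ +-cong (zeroˡ (b zero t)) refl ⟨
    0# * b zero t + _                     ∎

  -- The enumeration of F makes equality decidable and identifies vectors
  -- of F^m with Fin (q ^ m); in particular membership in a span is
  -- decidable (there are finitely many coefficient vectors to try).
  index : Carrier → Fin q
  index x = proj₁ (enum-surj x)

  enum-index : ∀ x → enum (index x) ≈ x
  enum-index x = proj₂ (enum-surj x)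

  index-cong : ∀ {x y} → x ≈ y → index x ≡ index y
  index-cong {x} {y} x≈y = enum-inj _ _ (trans (enum-index x) (trans x≈y (sym (enum-index y))))

  index-injective : ∀ {x y} → index x ≡ index y → x ≈ y
  index-injective {x} {y} e = trans (sym (enum-index x)) (trans (reflexive (≡.cong enum e)) (enum-index y))

  _≈?_ : ∀ x y → Dec (x ≈ y)
  x ≈? y with index x Fin.≟ index y
  ... | yes e = yes (index-injective e)
  ... | no ¬e = no (λ x≈y → ¬e (index-cong x≈y))

  2≤q : 2 ℕ.≤ q
  2≤q = Fin.injective⇒≤ {f = zero-or-one} injective
    where
    zero-or-one : Fin 2 → Fin q
    zero-or-one zero    = index 0#
    zero-or-one (suc _) = index 1#
    injective : Injective _≡_ _≡_ zero-or-one
    injective {zero}        {zero}        _ = ≡.refl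
    injective {zero}        {suc zero}    e = ⊥-elim (0≉1 (index-injective e))
    injective {suc zero}    {zero}        e = ⊥-elim (0≉1 (index-injective (≡.sym e)))
    injective {suc zero}    {suc zero}    _ = ≡.refl

  encode : ∀ {m} → Vector m → Fin (q ^ m)
  encode v = funToFin (λ i → index (v i))

  decode : ∀ {m} → Fin (q ^ m) → Vector m
  decode c i = enum (finToFun c i)

  decode-encode : ∀ {m} (v : Vector m) i → decode (encode v) i ≈ v i
  decode-encode v i rewrite Fin.finToFun-funToFin (λ i → index (v i)) i = enum-index (v i)

  encode-injective : ∀ {m} {v w : Vector m} → encode v ≡ encode w → ∀ i → v i ≈ w i
  encode-injective {v = v} {w} e i = begin
    v i                   ≈⟨ decode-encode v i ⟨
    decode (encode v) i   ≡⟨ ≡.cong (λ c → decode c i) e ⟩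
    decode (encode w) i   ≈⟨ decode-encode w i ⟩
    w i                   ∎

  decode-injective : ∀ {m} (c d : Fin (q ^ m)) → (∀ i → decode c i ≈ decode d i) → c ≡ d
  decode-injective {m} c d c≈d =
    ≡.trans (≡.sym (Fin.funToFin-finToFin {m} {q} c))
      (≡.trans (funToFin-cong {m} (λ i → enum-inj _ _ (c≈d i))) (Fin.funToFin-finToFin {m} {q} d))
    where
    funToFin-cong : ∀ {m} {f g : Fin m → Fin q} → (∀ i → f i ≡ g i) → funToFin f ≡ funToFin g
    funToFin-cong {zero}  f≡g = ≡.refl
    funToFin-cong {suc m} f≡g = ≡.cong₂ combine (f≡g zero) (funToFin-cong (λ i → f≡g (suc i)))

  InSpan? : ∀ {k n} (b : Fin k → Vector n) (v : Vector n) → Dec (InSpan b v)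
  InSpan? {k} b v with Fin.any? (λ c → Fin.all? (λ t → v t ≈? (decode c · b) t))
  ... | yes (c , v≈cb) = yes (decode c , v≈cb)
  ... | no ¬∃c = no λ { (c , v≈cb) → ¬∃c (encode c , λ t →
          trans (v≈cb t) (Σ-cong k (λ i → *-cong (sym (decode-encode c i)) refl))) }

  -- Dimension.  The coefficient map of k independent vectors of F^m is
  -- injective, so q^k ≤ q^m; hence F^m has no m+1 independent vectors,
  -- and m independent vectors of F^m span it.
  -- (c - d) · u = c · u - d · u
  ·-sub : ∀ {k n} (c d : Fin k → Carrier) (u : Fin k → Vector n) t →
          ((λ i → c i - d i) · u) t ≈ (c · u) t - (d · u) t
  ·-sub {k} c d u t = begin
    Σ[< k ] (λ i → (c i - d i) * u i t)            ≈⟨ Σ-cong k (λ i → [y-z]x≈yx-zx (u i t) (c i) (d i)) ⟩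
    Σ[< k ] (λ i → c i * u i t - d i * u i t)      ≈⟨ Σ-+ k _ _ ⟩
    (c · u) t + Σ[< k ] (λ i → - (d i * u i t))    ≈⟨ +-cong refl (Σ-neg k _) ⟩
    (c · u) t - (d · u) t                          ∎

  indep-bound : ∀ {k m} (u : Fin k → Vector m) → LinIndep u → q ^ k ℕ.≤ q ^ m
  indep-bound {k} {m} u u-indep = Fin.injective⇒≤ {f = combination} injective
    where
    combination : Fin (q ^ k) → Fin (q ^ m)
    combination c = encode (decode c · u)
    injective : Injective _≡_ _≡_ combination
    injective {c} {d} e = decode-injective c d λ i →
      x∙y⁻¹≈ε⇒x≈y _ _ (u-indep (λ i → decode c i - decode d i) difference≈0 i)
      where
      difference≈0 : ∀ t → ((λ i → decode c i - decode d i) · u) t ≈ 0#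
      difference≈0 t = trans (·-sub (decode c) (decode d) u t) (x≈y⇒x∙y⁻¹≈ε (encode-injective e t))

  no-indep : ∀ {m} (u : Fin (suc m) → Vector m) → ¬ LinIndep u
  no-indep {m} u u-indep = ℕ.<⇒≱ (ℕ.^-monoʳ-< q 2≤q (ℕ.n<1+n m)) (indep-bound u u-indep)

  indep-tail : ∀ {k n} (a : Fin (suc k) → Vector n) → LinIndep a → LinIndep (tail a)
  indep-tail a a-indep c c·a≈0 i =
    a-indep (0# ∷ c) (λ t → trans (+-cong (zeroˡ _) (c·a≈0 t)) (+-identityˡ 0#)) (suc i)

  solve-for : ∀ {c x s} y → y * c ≈ 1# → c * x + s ≈ 0# → x ≈ (- y) * s
  solve-for {c} {x} {s} y yc≈1 cx+s≈0 = begin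
    x            ≈⟨ *-identityˡ x ⟨
    1# * x       ≈⟨ *-cong yc≈1 refl ⟨
    (y * c) * x  ≈⟨ *-assoc y c x ⟩
    y * (c * x)  ≈⟨ *-cong refl (+-inverseˡ-unique _ _ cx+s≈0) ⟩
    y * - s      ≈⟨ -‿distribʳ-* y s ⟨
    - (y * s)    ≈⟨ -‿distribˡ-* y s ⟩
    (- y) * s    ∎

  indep-∷ : ∀ {k n} (b : Fin k → Vector n) x → LinIndep b → ¬ InSpan b x → LinIndep (x ∷ b)
  indep-∷ b x b-indep x∉b c c·xb≈0 with c zero ≈? 0#
  ... | yes c₀≈0 = λ { zero → c₀≈0 ; (suc i) → b-indep (tail c) rest≈0 i }
    where
    rest≈0 : ∀ t → (tail c · b) t ≈ 0#
    rest≈0 t = trans (sym (+-identityˡ _))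
      (trans (+-cong (sym (trans (*-cong c₀≈0 refl) (zeroˡ _))) refl) (c·xb≈0 t))
  ... | no c₀≉0 with inverse (c zero) c₀≉0
  ... | y , c₀y≈1 = ⊥-elim (x∉b (span-resp b (λ t → sym (solve-for y yc₀≈1 (c·xb≈0 t)))
                                    (span-* b (- y) (tail c , λ t → refl))))
    where
    yc₀≈1 : y * c zero ≈ 1#
    yc₀≈1 = trans (*-comm y (c zero)) c₀y≈1

  -- n independent vectors of F^n span F^n: a vector outside their span
  -- would give n+1 independent vectors
  spans-all : ∀ {n} (b : Fin n → Vector n) → LinIndep b → ∀ v → InSpan b v
  spans-all b b-indep v with InSpan? b v
  ... | yes v∈b = v∈b
  ... | no  v∉b = ⊥-elim (no-indep (v ∷ b) (indep-∷ b v b-indep v∉b))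

  -- Hyperplanes.  The hyperplanes of span a, for a : Fin (suc m) → Vector n
  -- independent, are listed by the codes Fin (qint (suc m)), where
  -- qint m = [m]_q = 1 + q + ⋯ + q^(m-1):
  -- * a code r : Fin (q ^ m) stands for the hyperplane avoiding a₀ that is
  --   the kernel of the functional a₀ ↦ 1, a_{j+1} ↦ r_j;
  -- * a code c : Fin (qint m) stands for the hyperplane through a₀ whose
  --   intersection with span (tail a) has code c.

  -- shear r a = (a₁ - r₀ a₀, …, aₘ - r_{m-1} a₀), a basis of the kernel of
  -- a₀ ↦ 1, a_{j+1} ↦ r_j
  shear : ∀ {m n} → (Fin m → Carrier) → (Fin (suc m) → Vector n) → Fin m → Vector n
  shear r a j t = a (suc j) t - r j * a zero t

  shear-span : ∀ {m n} r (a : Fin (suc m) → Vector n) → shear r a ⊆span a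
  shear-span r a j = span-+ a (span-member a (suc j))
    (span-resp a (λ t → sym (-‿distribˡ-* (r j) (a zero t))) (span-* a (- r j) (span-member a zero)))

  ·-shear : ∀ {m n} (e r : Fin m → Carrier) (a : Fin (suc m) → Vector n) t →
            (e · shear r a) t ≈ (((- Σ[< m ] (λ j → e j * r j)) ∷ e) · a) t
  ·-shear {m} e r a t = begin
    Σ[< m ] (λ j → e j * (a (suc j) t - r j * a zero t))
      ≈⟨ Σ-cong m (λ j → trans (x[y-z]≈xy-xz (e j) _ _) (+-cong refl (-‿cong (sym (*-assoc _ _ _))))) ⟩
    Σ[< m ] (λ j → e j * a (suc j) t - e j * r j * a zero t)
      ≈⟨ trans (Σ-+ m _ _) (+-cong refl (Σ-neg m _)) ⟩
    (e · tail a) t - Σ[< m ] (λ j → e j * r j * a zero t)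
      ≈⟨ +-cong refl (-‿cong (Σ-*ʳ m (a zero t) _)) ⟨
    (e · tail a) t - Σ[< m ] (λ j → e j * r j) * a zero t
      ≈⟨ trans (+-comm _ _) (+-cong (-‿distribˡ-* _ _) refl) ⟩
    (- Σ[< m ] (λ j → e j * r j)) * a zero t + (e · tail a) t
      ∎

  shear-indep : ∀ {m n} r (a : Fin (suc m) → Vector n) → LinIndep a → LinIndep (shear r a)
  shear-indep r a a-indep e e·s≈0 j =
    a-indep (_ ∷ e) (λ t → trans (sym (·-shear e r a t)) (e·s≈0 t)) (suc j)

  indep-head-∷ : ∀ {k m n} (a : Fin (suc k) → Vector n) (u : Fin m → Vector n) →
                 LinIndep a → u ⊆span tail a → LinIndep u → LinIndep (a zero ∷ u)
  indep-head-∷ {k} a u a-indep u⊆a u-indep e e·≈0 = λ { zero → coeffs≈0 zero ; (suc j) → tail-e≈0 j }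
    where
    -- Σ_{j} e_{j+1} u_j = Σ_i g_i a_{i+1}, so the e-combination is (e₀ ∷ g) · a
    tail-combination : InSpan (tail a) (tail e · u)
    tail-combination = span-lincomb (tail a) u u⊆a (tail e)
    g : Fin k → Carrier
    g = proj₁ tail-combination
    coeffs≈0 : ∀ i → (e zero ∷ g) i ≈ 0#
    coeffs≈0 = a-indep (e zero ∷ g) (λ t → trans (+-cong refl (sym (proj₂ tail-combination t))) (e·≈0 t))
    tail-e≈0 : ∀ j → e (suc j) ≈ 0#
    tail-e≈0 = u-indep (tail e) (λ t → trans (proj₂ tail-combination t)
      (Σ-zero _ _ (λ i → trans (*-cong (coeffs≈0 (suc i)) refl) (zeroˡ _))))

  mutual
    hyperplane : ∀ m {n} → Fin (qint (suc m)) → (Fin (suc m) → Vector n) → Fin m → Vector n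
    hyperplane m c a = hyperplane⊎ m (splitAt (q ^ m) c) a

    hyperplane⊎ : ∀ m {n} → Fin (q ^ m) ⊎ Fin (qint m) → (Fin (suc m) → Vector n) → Fin m → Vector n
    hyperplane⊎ m       (inj₁ r) a = shear (decode {m} r) a
    hyperplane⊎ (suc m) (inj₂ c) a = a zero ∷ hyperplane m c (tail a)

  avoiding : ∀ {m} → Vector m → Fin (qint (suc m))
  avoiding {m} r = encode r ↑ˡ qint m

  through : ∀ {m} → Fin (qint (suc m)) → Fin (qint (suc (suc m)))
  through {m} c = q ^ suc m ↑ʳ c

  hyperplane-avoiding : ∀ m {n} r (a : Fin (suc m) → Vector n) →
                        hyperplane m (avoiding {m} r) a ≡ shear (decode (encode {m} r)) a
  hyperplane-avoiding m r a = ≡.cong (λ s → hyperplane⊎ m s a) (Fin.splitAt-↑ˡ (q ^ m) (encode {m} r) (qint m))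

  hyperplane-through : ∀ m {n} c (a : Fin (suc (suc m)) → Vector n) →
                       hyperplane (suc m) (through {m} c) a ≡ a zero ∷ hyperplane m c (tail a)
  hyperplane-through m c a = ≡.cong (λ s → hyperplane⊎ (suc m) s a) (Fin.splitAt-↑ʳ (q ^ suc m) (qint (suc m)) c)

  mutual
    hyperplane-span : ∀ m {n} c (a : Fin (suc m) → Vector n) → hyperplane m c a ⊆span a
    hyperplane-span m c a = hyperplane⊎-span m (splitAt (q ^ m) c) a

    hyperplane⊎-span : ∀ m {n} s (a : Fin (suc m) → Vector n) → hyperplane⊎ m s a ⊆span a
    hyperplane⊎-span m       (inj₁ r) a = shear-span (decode {m} r) a
    hyperplane⊎-span (suc m) (inj₂ c) a =
      ∷-⊆span {b = a} (span-member a zero) (λ j → span-tail a (hyperplane-span m c (tail a) j))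

  mutual
    hyperplane-indep : ∀ m {n} c (a : Fin (suc m) → Vector n) → LinIndep a → LinIndep (hyperplane m c a)
    hyperplane-indep m c a = hyperplane⊎-indep m (splitAt (q ^ m) c) a

    hyperplane⊎-indep : ∀ m {n} s (a : Fin (suc m) → Vector n) → LinIndep a → LinIndep (hyperplane⊎ m s a)
    hyperplane⊎-indep m       (inj₁ r) a = shear-indep (decode {m} r) a
    hyperplane⊎-indep (suc m) (inj₂ c) a a-indep =
      indep-head-∷ a _ a-indep (hyperplane-span m c (tail a))
        (hyperplane-indep m c (tail a) (indep-tail a a-indep))

  -- Elimination.  If a_j ≡ w_j e modulo span b for every j, the kernel of
  -- the functional a_j ↦ w_j is a hyperplane of span a lying in span b.
  minus-null : ∀ {x y} → y ≈ 0# → x - y ≈ x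
  minus-null y≈0 = trans (+-cong refl (trans (-‿cong y≈0) -0#≈0#)) (+-identityʳ _)

  subtract-summand : ∀ {x y z} → x ≈ y + z → x - y ≈ z
  subtract-summand {x} {y} {z} x≈y+z = begin
    x - y          ≈⟨ +-cong x≈y+z refl ⟩
    (y + z) - y    ≈⟨ +-cong (+-comm y z) refl ⟩
    (z + y) - y    ≈⟨ +-assoc z y (- y) ⟩
    z + (y - y)    ≈⟨ +-cong refl (-‿inverseʳ y) ⟩
    z + 0#         ≈⟨ +-identityʳ z ⟩
    z              ∎

  sub-telescope : ∀ p r u → (p - r) + (r - u) ≈ p - u
  sub-telescope p r u = begin
    (p - r) + (r - u)     ≈⟨ +-assoc p (- r) (r - u) ⟩
    p + (- r + (r - u))   ≈⟨ +-cong refl (+-assoc (- r) r (- u)) ⟨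
    p + ((- r + r) - u)   ≈⟨ +-cong refl (+-cong (-‿inverseˡ r) refl) ⟩
    p + (0# - u)          ≈⟨ +-cong refl (+-identityˡ (- u)) ⟩
    p - u                 ∎

  eliminate : ∀ {a' a₀ w' w₀ e v} → v * w₀ ≈ w' →
              (a' - w' * e) + (- v) * (a₀ - w₀ * e) ≈ a' - v * a₀
  eliminate {a'} {a₀} {w'} {w₀} {e} {v} vw₀≈w' = begin
    (a' - w' * e) + (- v) * (a₀ - w₀ * e)       ≈⟨ +-cong refl (-‿distribˡ-* v _) ⟨
    (a' - w' * e) + - (v * (a₀ - w₀ * e))       ≈⟨ +-cong refl (-‿cong (x[y-z]≈xy-xz v a₀ (w₀ * e))) ⟩
    (a' - w' * e) + - (v * a₀ - v * (w₀ * e))   ≈⟨ +-cong refl (⁻¹-anti-homo‿- _ _) ⟩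
    (a' - w' * e) + (v * (w₀ * e) - v * a₀)     ≈⟨ +-cong refl (+-cong v[w₀e]≈w'e refl) ⟩
    (a' - w' * e) + (w' * e - v * a₀)           ≈⟨ sub-telescope a' (w' * e) (v * a₀) ⟩
    a' - v * a₀                                 ∎
    where
    v[w₀e]≈w'e : v * (w₀ * e) ≈ w' * e
    v[w₀e]≈w'e = trans (sym (*-assoc v w₀ e)) (*-cong vw₀≈w' refl)

  -- the case w₀ ≠ 0: the kernel avoids a₀ and is the shear by (w_{j+1}/w₀)_j
  kernel-avoiding : ∀ m {k n} (b : Fin k → Vector n) (e : Vector n)
    (a : Fin (suc m) → Vector n) (w : Fin (suc m) → Carrier) → ¬ (w zero ≈ 0#) →
    (∀ j → InSpan b (λ t → a j t - w j * e t)) → ∃ λ c → hyperplane m c a ⊆span b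
  kernel-avoiding m b e a w w₀≉0 a≡we with inverse (w zero) w₀≉0
  ... | y , w₀y≈1 = avoiding {m} v , ≡.subst (_⊆span b) (≡.sym (hyperplane-avoiding m v a)) sheared
    where
    v : Vector m
    v j = w (suc j) * y
    v-scales : ∀ j → v j * w zero ≈ w (suc j)
    v-scales j = trans (*-assoc _ _ _) (trans (*-cong refl (trans (*-comm y _) w₀y≈1)) (*-identityʳ _))
    sheared : shear (decode (encode v)) a ⊆span b
    sheared j = span-resp b
      (λ t → trans (eliminate (v-scales j)) (+-cong refl (-‿cong (*-cong (sym (decode-encode v j)) refl))))
      (span-+ b (a≡we (suc j)) (span-* b (- v j) (a≡we zero)))

  -- the case w₀ = 0: a₀ lies in span b, and the kernel is a₀ together with
  -- the kernel of the functional restricted to span (tail a)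
  kernel-hyperplane : ∀ m {k n} (b : Fin k → Vector n) (e : Vector n)
    (a : Fin (suc m) → Vector n) (w : Fin (suc m) → Carrier) →
    (∀ j → InSpan b (λ t → a j t - w j * e t)) → ∃ λ c → hyperplane m c a ⊆span b
  kernel-hyperplane m b e a w a≡we with w zero ≈? 0#
  ... | no w₀≉0 = kernel-avoiding m b e a w w₀≉0 a≡we
  kernel-hyperplane zero    b e a w a≡we | yes _ = zero , λ ()
  kernel-hyperplane (suc m) b e a w a≡we | yes w₀≈0
    with kernel-hyperplane m b e (tail a) (tail w) (a≡we ∘ suc)
  ... | c , H⊆b = through {m} c , ≡.subst (_⊆span b) (≡.sym (hyperplane-through m c a)) (∷-⊆span a₀∈b H⊆b)
    where
    a₀∈b : InSpan b (a zero)
    a₀∈b = span-resp b (λ t → minus-null (trans (*-cong w₀≈0 refl) (zeroˡ _))) (a≡we zero)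

  -- Any m+1 vectors a of F^(m+2) span a space with a hyperplane inside the
  -- span of any m+1 independent vectors b: either a ⊆ span b, or some aₚ
  -- completes b to a basis and we eliminate along aₚ.
  common-hyperplane : ∀ m (a b : Fin (suc m) → Vector (suc (suc m))) → LinIndep b →
                      ∃ λ c → hyperplane m c a ⊆span b
  common-hyperplane m a b b-indep with Fin.all? (λ j → InSpan? b (a j))
  ... | yes a⊆b = kernel-hyperplane m b (a zero) a (λ _ → 0#)
                    (λ j → span-resp b (λ t → sym (minus-null (zeroˡ _))) (a⊆b j))
  ... | no a⊈b with Fin.¬∀⟶∃¬ _ _ (λ j → InSpan? b (a j)) a⊈b
  ...   | p , aₚ∉b = kernel-hyperplane m b (a p) a (λ j → proj₁ (decompose j) zero) modulo-b
    where
    decompose : ∀ j → InSpan (a p ∷ b) (a j)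
    decompose = spans-all (a p ∷ b) (indep-∷ b (a p) b-indep aₚ∉b) ∘ a
    modulo-b : ∀ j → InSpan b (λ t → a j t - proj₁ (decompose j) zero * a p t)
    modulo-b j = tail (proj₁ (decompose j)) , λ t → subtract-summand (proj₂ (decompose j) t)

  -- The packing bound.  Every block other than the first is labelled by a
  -- hyperplane of the first block that it contains; the labels have fibres
  -- of size at most q - 1, and 1 + (q - 1)[m+1]_q = q^(m+1).
  q-nonZero : ℕ.NonZero q
  q-nonZero = ℕ.>-nonZero (ℕ.<-trans ℕ.z<s 2≤q)

  packing-bound : ∀ m {N} (blocks : Fin N → Subspace (suc m) (suc (suc m))) →
                  IsPacking (suc (suc m)) (suc m) m q blocks → N ℕ.≤ q ^ suc m
  packing-bound m {zero}  blocks packing = ℕ.z≤n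
  packing-bound m {suc N} blocks packing =
    ≡.subst (suc N ℕ.≤_) (≡.trans (ℕ.+-comm 1 _) (qint-identity {{q-nonZero}} (suc m)))
      (ℕ.s≤s (pigeonhole-mult (ℕ.pred q) label small-fibres))
    where
    a : Fin (suc m) → Vector (suc (suc m))
    a = basis (blocks zero)
    shared : ∀ i → ∃ λ c → hyperplane m c a ⊆span basis (blocks (suc i))
    shared i = common-hyperplane m a (basis (blocks (suc i))) (indep (blocks (suc i)))
    label : Fin N → Fin (qint (suc m))
    label = proj₁ ∘ shared
    H : Fin (qint (suc m)) → Subspace m (suc (suc m))
    H c = record { basis = hyperplane m c a ; indep = hyperplane-indep m c a (indep (blocks zero)) }
    -- the blocks labelled c, preceded by the first block, all contain H c
    small-fibres : ∀ c l (f : Fin l → Fin N) → Injective _≡_ _≡_ f → (∀ j → label (f j) ≡ c) → l ℕ.≤ ℕ.pred q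
    small-fibres c l f f-injective f↦c =
      ℕ.suc[m]≤n⇒m≤pred[n] (packing (H c) (suc l) (lift 1 f) (Fin.lift-injective f f-injective 1) contains)
      where
      contains : ∀ j → H c ⊆ˢ blocks (lift 1 f j)
      contains zero    = hyperplane-span m c a
      contains (suc j) = ≡.subst (λ c → hyperplane m c a ⊆span basis (blocks (suc (f j)))) (f↦c j) (proj₂ (shared (f j)))

-- A packing without repeated blocks is in particular a packing with
-- multiplicities, so both bounds are the packing bound with n = m + 2.
lemma10 : ∀ (q : ℕ) (F : FiniteField q) (n : ℕ) → 3 ≤ n →
    (∀ (N : ℕ) (blocks : Fin N → Subspaces.Subspace F (n ∸ 1) n) →
      Subspaces.IsPacking F n (n ∸ 1) (n ∸ 2) q blocks →
      Subspaces.NoRepeats F blocks → N ≤ q ^ (n ∸ 1))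
    ×
    (∀ (N : ℕ) (blocks : Fin N → Subspaces.Subspace F (n ∸ 1) n) →
      Subspaces.IsPacking F n (n ∸ 1) (n ∸ 2) q blocks →
      N ≤ q ^ (n ∸ 1))
lemma10 q F (suc zero)       (s≤s ())
lemma10 q F (suc (suc zero)) (s≤s (s≤s ()))
lemma10 q F (suc (suc (suc k))) _ =
  (λ N blocks packing _ → packing-bound (suc k) blocks packing) ,
  (λ N blocks packing → packing-bound (suc k) blocks packing)
  where open LinearAlgebra F using (packing-bound)
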